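{- Let $G$ be a graph and let $k$ be a nonnegative integer such that $|\mathrm{core}(L_G^c)|+|\mathrm{corona}(L_G^c)|=2\alpha(L_G^c)+k$. Then $|\mathrm{core}(G)|+|\mathrm{corona}(G)|=2\alpha(G)+k$.
   Context: All graphs are finite, simple and undirected. $\alpha(H)$ is the maximum size of an independent set of $H$; $\Omega(H)$ is the family of maximum independent sets of $H$; $\mathrm{core}(H)=\bigcap_{S\in\Omega(H)}S$ and $\mathrm{corona}(H)=\bigcup_{S\in\Omega(H)}S$ (for the graph with no vertices, $\alpha=0$ and core and corona are empty). For $S\subseteq V(G)$, $N(S)$ is the set of vertices adjacent to some vertex of $S$. An independent set $I$ is critical if $|I|-|N(I)|=\max\{|J|-|N(J)|:J\subseteq V(G)\}$; a maximum critical independent set is a critical independent set of maximum cardinality. Larson's set $L(G)$ is defined as $L(G)=J\cup N(J)$ for a maximum critical independent set $J$ of $G$ (this is known to be independent of the choice of $J$). Let $L^c(G)=V(G)\setminus L(G)$, $L_G=G[L(G)]$ and $L_G^c=G[L^c(G)]$. -}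

module Defs where

open import Data.Nat using (ℕ; zero; suc; _≡ᵇ_; _⊔_; _≤_)
open import Data.Bool using (Bool; true; false; _∧_; _∨_; not)
open import Data.Fin using (Fin; zero; suc)
open import Data.Fin.Subset using (Subset; inside; outside; ∣_∣; _∪_; ∁; ⋂; ⋃; ⊤)
open import Data.Vec using (Vec; []; _∷_; lookup; tabulate)
open import Data.List using (List; [_]; _++_; map; filter; foldr)
open import Data.Integer using (ℤ; +_; _-_) renaming (_≤_ to _≤ℤ_)
open import Data.Product using (_×_)
open import Relation.Binary.PropositionalEquality using (_≡_)
open import Relation.Nullary.Decidable using (T?)
open import Function using (_∘_)

record Graph (n : ℕ) : Set where
  field
    adj    : Fin n → Fin n → Bool
    sym    : ∀ x y → adj x y ≡ adj y x
    irrefl : ∀ x → adj x x ≡ false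
open Graph public

anyV : ∀ {n} → (Fin n → Bool) → Bool
anyV {zero}  f = false
anyV {suc n} f = f zero ∨ anyV (f ∘ suc)

allV : ∀ {n} → (Fin n → Bool) → Bool
allV f = not (anyV (not ∘ f))

allSubsets : ∀ n → List (Subset n)
allSubsets zero    = [ [] ]
allSubsets (suc n) = map (inside ∷_) (allSubsets n) ++ map (outside ∷_) (allSubsets n)

_⊆ᵇ_ : ∀ {n} → Subset n → Subset n → Bool
S ⊆ᵇ W = allV (λ x → not (lookup S x) ∨ lookup W x)

isIndep : ∀ {n} → Graph n → Subset n → Bool
isIndep G S = not (anyV (λ x → anyV (λ y → lookup S x ∧ lookup S y ∧ adj G x y)))

N : ∀ {n} → Graph n → Subset n → Subset n
N G S = tabulate (λ x → anyV (λ y → lookup S y ∧ adj G x y))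

-- The induced subgraph G[W] is represented by the vertex set W ⊆ Fin n:
-- independent sets of G[W] are exactly the independent sets of G contained in W.
indepSetsIn : ∀ {n} → Graph n → Subset n → List (Subset n)
indepSetsIn {n} G W = filter (λ S → T? (isIndep G S ∧ (S ⊆ᵇ W))) (allSubsets n)

α : ∀ {n} → Graph n → Subset n → ℕ
α G W = foldr _⊔_ 0 (map ∣_∣ (indepSetsIn G W))

Ω : ∀ {n} → Graph n → Subset n → List (Subset n)
Ω G W = filter (λ S → T? (∣ S ∣ ≡ᵇ α G W)) (indepSetsIn G W)

-- core(G[W]) and corona(G[W]) (Ω is never empty: ∅ is independent)
core : ∀ {n} → Graph n → Subset n → Subset n
core G W = ⋂ (Ω G W)

corona : ∀ {n} → Graph n → Subset n → Subset n
corona G W = ⋃ (Ω G W)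

diff : ∀ {n} → Graph n → Subset n → ℤ
diff G J = + ∣ J ∣ - + ∣ N G J ∣

IsCriticalIndep : ∀ {n} → Graph n → Subset n → Set
IsCriticalIndep G J = (isIndep G J ≡ true) × (∀ J′ → diff G J′ ≤ℤ diff G J)

IsMaxCriticalIndep : ∀ {n} → Graph n → Subset n → Set
IsMaxCriticalIndep G J = IsCriticalIndep G J × (∀ J′ → IsCriticalIndep G J′ → ∣ J′ ∣ ≤ ∣ J ∣)

-- Larson's set L(G) = J ∪ N(J) computed from a maximum critical independent set J,
-- and its complement L^c(G).
Lset : ∀ {n} → Graph n → Subset n → Subset n
Lset G J = J ∪ N G J

Lcset : ∀ {n} → Graph n → Subset n → Subset n
Lcset G J = ∁ (Lset G J)

{-# OPTIONS --safe #-}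

-- Let J be a critical independent set, R the complement of J ∪ N(J) and C = corona(G) ∩ N(J).
-- Comparing J with J ∖ N(T) in the criticality inequality gives Hall's condition
-- ∣T∣ ≤ ∣J ∩ N(T)∣ for T ⊆ N(J), so an independent set has at most ∣J∣ vertices in J ∪ N(J).
-- Hence α(G) = ∣J∣ + α(G[R]), and S ↦ S ∩ R, S ↦ J ∪ S carry maximum independent sets between
-- G and G[R]: on R, core and corona of G are those of G[R]; J lies in the corona and N(J) misses
-- the core. For a maximum S, Hall's condition is tight for S ∩ N(J), which forces every vertex of
-- J ∖ S into N(S ∩ N(J)); tightness survives unions, so it holds for C, and core(G) ∩ J = J ∖ N(C).
-- Thus J ∪ N(J) contributes ∣J ∖ N(C)∣ + ∣J∣ + ∣J ∩ N(C)∣ = 2∣J∣ to ∣core(G)∣ + ∣corona(G)∣.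

module Submission where

open import Defs
open import Data.Bool using (Bool; true; false; T; not; _∧_; _∨_)
open import Data.Bool.Properties using (T-≡; T-∧; T-∨)
open import Data.Empty using (⊥-elim)
open import Data.Fin using (Fin; zero; suc)
open import Data.Fin.Subset
  using (Subset; inside; outside; _∈_; _∉_; _⊆_; _∩_; _∪_; ∁; ⋂; ⋃; ⊤; ∣_∣; Empty)
  renaming (⊥ to ∅)
open import Data.Fin.Subset.Properties
import Data.Integer as ℤ
import Data.Integer.Properties as ℤₚ
import Data.Integer.Tactic.RingSolver as ℤ-Solver
open import Data.List using ([]; _∷_; map; foldr)
open import Data.List.Membership.Propositional using (lose; find) renaming (_∈_ to _∈ˡ_)
open import Data.List.Membership.Propositional.Properties
  using (∈-filter⁺; ∈-filter⁻; ∈-map⁺; ∈-map⁻; ∈-++⁺ˡ; ∈-++⁺ʳ; foldr-selective)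
open import Data.List.Properties using (foldr-preservesᵒ)
open import Data.List.Relation.Unary.All as All using (All; []; _∷_)
open import Data.List.Relation.Unary.Any as Any using (Any; here; there)
open import Data.Nat using (ℕ; zero; suc; _+_; _*_; _≤_; _⊔_; _≡ᵇ_)
open import Data.Nat.Properties
open import Data.Nat.Tactic.RingSolver using (solve-∀)
open import Data.Product using (∃; _×_; _,_; proj₁; proj₂)
open import Data.Sum as Sum using (inj₁; inj₂; [_,_]′)
open import Data.Vec using ([]; _∷_; lookup; tabulate)
open import Data.Vec.Properties using (lookup∘tabulate; []=⇒lookup; lookup⇒[]=)
open import Function using (_∘_; id; Equivalence)
open import Relation.Binary.PropositionalEquality
  using (_≡_; refl; trans; cong; cong₂; subst; module ≡-Reasoning)
import Relation.Binary.PropositionalEquality as ≡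
open import Relation.Nullary using (¬_; yes; no)
open import Relation.Nullary.Decidable using (T?; decidable-stable)

open Equivalence using (to; from)

private
  variable
    n : ℕ

+-mono-≤-tight : ∀ {a b c d} → a ≤ c → b ≤ d → a + b ≡ c + d → a ≡ c × b ≡ d
+-mono-≤-tight {a} {b} {c} {d} a≤c b≤d a+b≡c+d =
  ≤-antisym a≤c (+-cancelʳ-≤ b c a (≤-trans (+-monoʳ-≤ c b≤d) (≤-reflexive (≡.sym a+b≡c+d)))) ,
  ≤-antisym b≤d (+-cancelˡ-≤ a d b (≤-trans (+-monoˡ-≤ d a≤c) (≤-reflexive (≡.sym a+b≡c+d))))

m-n≤p-q⇒m+q≤p+n : ∀ m n p q → ℤ.+ m ℤ.- ℤ.+ n ℤ.≤ ℤ.+ p ℤ.- ℤ.+ q → m + q ≤ p + n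
m-n≤p-q⇒m+q≤p+n m n p q m-n≤p-q = ℤₚ.drop‿+≤+ (begin
  + (m + q)                     ≡⟨ ℤₚ.pos-+ m q ⟩
  + m +ℤ + q                    ≡⟨ cancelʳ (+ m) (+ n) (+ q) ⟨
  (+ m - + n) +ℤ (+ q +ℤ + n)   ≤⟨ ℤₚ.+-monoˡ-≤ (+ q +ℤ + n) m-n≤p-q ⟩
  (+ p - + q) +ℤ (+ q +ℤ + n)   ≡⟨ cancelˡ (+ p) (+ q) (+ n) ⟩
  + p +ℤ + n                    ≡⟨ ℤₚ.pos-+ p n ⟨
  + (p + n)                     ∎)
  where
  open ℤₚ.≤-Reasoning
  open ℤ using (+_; _-_) renaming (_+_ to _+ℤ_)
  cancelʳ : ∀ a b c → (a - b) +ℤ (c +ℤ b) ≡ a +ℤ c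
  cancelˡ : ∀ a b c → (a - b) +ℤ (b +ℤ c) ≡ a +ℤ c
  cancelʳ = ℤ-Solver.solve-∀
  cancelˡ = ℤ-Solver.solve-∀

∣p∪q∣+∣p∩q∣≡∣p∣+∣q∣ : ∀ (p q : Subset n) → ∣ p ∪ q ∣ + ∣ p ∩ q ∣ ≡ ∣ p ∣ + ∣ q ∣
∣p∪q∣+∣p∩q∣≡∣p∣+∣q∣ []            []            = refl
∣p∪q∣+∣p∩q∣≡∣p∣+∣q∣ (outside ∷ p) (outside ∷ q) = ∣p∪q∣+∣p∩q∣≡∣p∣+∣q∣ p q
∣p∪q∣+∣p∩q∣≡∣p∣+∣q∣ (inside  ∷ p) (outside ∷ q) = cong suc (∣p∪q∣+∣p∩q∣≡∣p∣+∣q∣ p q)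
∣p∪q∣+∣p∩q∣≡∣p∣+∣q∣ (outside ∷ p) (inside  ∷ q) =
  trans (cong suc (∣p∪q∣+∣p∩q∣≡∣p∣+∣q∣ p q)) (≡.sym (+-suc ∣ p ∣ ∣ q ∣))
∣p∪q∣+∣p∩q∣≡∣p∣+∣q∣ (inside  ∷ p) (inside  ∷ q) = cong suc (begin
  ∣ p ∪ q ∣ + suc ∣ p ∩ q ∣ ≡⟨ +-suc ∣ p ∪ q ∣ ∣ p ∩ q ∣ ⟩
  suc (∣ p ∪ q ∣ + ∣ p ∩ q ∣) ≡⟨ cong suc (∣p∪q∣+∣p∩q∣≡∣p∣+∣q∣ p q) ⟩
  suc (∣ p ∣ + ∣ q ∣)         ≡⟨ +-suc ∣ p ∣ ∣ q ∣ ⟨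
  ∣ p ∣ + suc ∣ q ∣           ∎)
  where open ≡-Reasoning

∣p∩q∣+∣p∩∁q∣≡∣p∣ : ∀ (p q : Subset n) → ∣ p ∩ q ∣ + ∣ p ∩ ∁ q ∣ ≡ ∣ p ∣
∣p∩q∣+∣p∩∁q∣≡∣p∣ []            []            = refl
∣p∩q∣+∣p∩∁q∣≡∣p∣ (outside ∷ p) (_       ∷ q) = ∣p∩q∣+∣p∩∁q∣≡∣p∣ p q
∣p∩q∣+∣p∩∁q∣≡∣p∣ (inside  ∷ p) (inside  ∷ q) = cong suc (∣p∩q∣+∣p∩∁q∣≡∣p∣ p q)
∣p∩q∣+∣p∩∁q∣≡∣p∣ (inside  ∷ p) (outside ∷ q) =
  trans (+-suc ∣ p ∩ q ∣ ∣ p ∩ ∁ q ∣) (cong suc (∣p∩q∣+∣p∩∁q∣≡∣p∣ p q))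

Empty[p∩q]⇒∣p∪q∣≡∣p∣+∣q∣ : ∀ (p q : Subset n) → Empty (p ∩ q) → ∣ p ∪ q ∣ ≡ ∣ p ∣ + ∣ q ∣
Empty[p∩q]⇒∣p∪q∣≡∣p∣+∣q∣ {n} p q disjoint = begin
  ∣ p ∪ q ∣             ≡⟨ +-identityʳ ∣ p ∪ q ∣ ⟨
  ∣ p ∪ q ∣ + 0         ≡⟨ cong (∣ p ∪ q ∣ +_) ∣p∩q∣≡0 ⟨
  ∣ p ∪ q ∣ + ∣ p ∩ q ∣ ≡⟨ ∣p∪q∣+∣p∩q∣≡∣p∣+∣q∣ p q ⟩
  ∣ p ∣ + ∣ q ∣         ∎
  where
  open ≡-Reasoning
  ∣p∩q∣≡0 : ∣ p ∩ q ∣ ≡ 0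
  ∣p∩q∣≡0 = trans (cong ∣_∣ (Empty-unique disjoint)) (∣⊥∣≡0 n)

p⊆q∧∣q∣≤∣p∣⇒q⊆p : ∀ {p q : Subset n} → p ⊆ q → ∣ q ∣ ≤ ∣ p ∣ → q ⊆ p
p⊆q∧∣q∣≤∣p∣⇒q⊆p {p = p} p⊆q ∣q∣≤∣p∣ {x} x∈q with x ∈? p
... | yes x∈p = x∈p
... | no  x∉p = ⊥-elim (<⇒≱ (p⊂q⇒∣p∣<∣q∣ (p⊆q , x , x∈q , x∉p)) ∣q∣≤∣p∣)

∈⋂⁺ : ∀ {x : Fin n} ps → All (x ∈_) ps → x ∈ ⋂ ps
∈⋂⁺ []       []          = ∈⊤
∈⋂⁺ (p ∷ ps) (x∈p ∷ x∈ps) = x∈p∩q⁺ (x∈p , ∈⋂⁺ ps x∈ps)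

∈⋂⁻ : ∀ {x : Fin n} ps → x ∈ ⋂ ps → All (x ∈_) ps
∈⋂⁻ []       _ = []
∈⋂⁻ (p ∷ ps) x∈⋂ = let x∈p , x∈⋂ps = x∈p∩q⁻ p (⋂ ps) x∈⋂ in x∈p ∷ ∈⋂⁻ ps x∈⋂ps

∈⋃⁺ : ∀ {x : Fin n} ps → Any (x ∈_) ps → x ∈ ⋃ ps
∈⋃⁺ (p ∷ ps) (here  x∈p) = x∈p∪q⁺ (inj₁ x∈p)
∈⋃⁺ (p ∷ ps) (there x∈⋃) = x∈p∪q⁺ (inj₂ (∈⋃⁺ ps x∈⋃))

∈⋃⁻ : ∀ {x : Fin n} ps → x ∈ ⋃ ps → Any (x ∈_) ps
∈⋃⁻ []       x∈∅ = ⊥-elim (∉⊥ x∈∅)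
∈⋃⁻ (p ∷ ps) x∈⋃ = [ here , there ∘ ∈⋃⁻ ps ]′ (x∈p∪q⁻ p (⋃ ps) x∈⋃)

T-not⁺ : ∀ {b} → ¬ T b → T (not b)
T-not⁺ {false} _  = _
T-not⁺ {true}  ¬t = ¬t _

T-not⁻ : ∀ {b} → T (not b) → ¬ T b
T-not⁻ {false} _ ()

T-not-∨⁺ : ∀ {a b} → (T a → T b) → T (not a ∨ b)
T-not-∨⁺ {false} _ = _
T-not-∨⁺ {true}  f = f _

T-not-∨⁻ : ∀ {a b} → T (not a ∨ b) → T a → T b
T-not-∨⁻ {true} t _ = t

anyV⁺ : (f : Fin n → Bool) {x : Fin n} → T (f x) → T (anyV f)
anyV⁺ f {zero}  t = from (T-∨ {f zero}) (inj₁ t)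
anyV⁺ f {suc x} t = from (T-∨ {f zero}) (inj₂ (anyV⁺ (f ∘ suc) t))

anyV⁻ : (f : Fin n → Bool) → T (anyV f) → ∃ (T ∘ f)
anyV⁻ {suc n} f t with to (T-∨ {f zero}) t
... | inj₁ t₀ = zero , t₀
... | inj₂ t₁ with anyV⁻ (f ∘ suc) t₁
...   | x , tx = suc x , tx

allV⁺ : (f : Fin n → Bool) → (∀ x → T (f x)) → T (allV f)
allV⁺ f h = T-not⁺ λ t → let x , t′ = anyV⁻ _ t in T-not⁻ t′ (h x)

allV⁻ : (f : Fin n → Bool) → T (allV f) → ∀ x → T (f x)
allV⁻ f t x = decidable-stable (T? (f x)) λ ¬fx → T-not⁻ t (anyV⁺ (not ∘ f) (T-not⁺ ¬fx))

∈⇒T-lookup : ∀ {x : Fin n} {p} → x ∈ p → T (lookup p x)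
∈⇒T-lookup x∈p = from T-≡ ([]=⇒lookup x∈p)

T-lookup⇒∈ : ∀ {x : Fin n} {p} → T (lookup p x) → x ∈ p
T-lookup⇒∈ {x = x} {p} t = lookup⇒[]= x p (to T-≡ t)

∈-tabulate⁺ : ∀ {f : Fin n → Bool} {x} → T (f x) → x ∈ tabulate f
∈-tabulate⁺ {f = f} {x} t = T-lookup⇒∈ (subst T (≡.sym (lookup∘tabulate f x)) t)

∈-tabulate⁻ : ∀ {f : Fin n → Bool} {x} → x ∈ tabulate f → T (f x)
∈-tabulate⁻ {f = f} {x} x∈ = subst T (lookup∘tabulate f x) (∈⇒T-lookup x∈)

≤-foldr-⊔ : ∀ {m : ℕ} {ms} → m ∈ˡ ms → m ≤ foldr _⊔_ 0 ms
≤-foldr-⊔ m∈ms = foldr-preservesᵒ (λ a b → [ m≤n⇒m≤n⊔o b , m≤n⇒m≤o⊔n a ]′) 0 _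
  (inj₂ (Any.map ≤-reflexive m∈ms))

∈-allSubsets : (S : Subset n) → S ∈ˡ allSubsets n
∈-allSubsets []                    = here refl
∈-allSubsets         (inside  ∷ S) = ∈-++⁺ˡ (∈-map⁺ (inside ∷_) (∈-allSubsets S))
∈-allSubsets {suc n} (outside ∷ S) =
  ∈-++⁺ʳ (map (inside ∷_) (allSubsets n)) (∈-map⁺ (outside ∷_) (∈-allSubsets S))

⊆⇒⊆ᵇ : ∀ {S W : Subset n} → S ⊆ W → T (S ⊆ᵇ W)
⊆⇒⊆ᵇ {S = S} {W} S⊆W = allV⁺ (λ x → not (lookup S x) ∨ lookup W x) λ x →
  T-not-∨⁺ {lookup S x} (∈⇒T-lookup ∘ S⊆W ∘ T-lookup⇒∈)

⊆ᵇ⇒⊆ : ∀ {S W : Subset n} → T (S ⊆ᵇ W) → S ⊆ W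
⊆ᵇ⇒⊆ {S = S} {W} t {x} x∈S =
  T-lookup⇒∈ (T-not-∨⁻ (allV⁻ (λ x → not (lookup S x) ∨ lookup W x) t x) (∈⇒T-lookup x∈S))

module _ (G : Graph n) where

  Independent : Subset n → Set
  Independent S = ∀ {x y} → x ∈ S → y ∈ S → ¬ T (adj G x y)

  adj-sym : ∀ {x y} → T (adj G x y) → T (adj G y x)
  adj-sym {x} {y} = subst T (Graph.sym G x y)

  ∈N⁺ : ∀ {S x y} → y ∈ S → T (adj G x y) → x ∈ N G S
  ∈N⁺ {S} {x} {y} y∈S xy =
    ∈-tabulate⁺ (anyV⁺ _ {y} (from (T-∧ {lookup S y}) (∈⇒T-lookup y∈S , xy)))

  ∈N⁻ : ∀ {S x} → x ∈ N G S → ∃ λ y → y ∈ S × T (adj G x y)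
  ∈N⁻ {S} x∈NS with anyV⁻ _ (∈-tabulate⁻ x∈NS)
  ... | y , t = let y∈S , xy = to (T-∧ {lookup S y}) t in y , T-lookup⇒∈ y∈S , xy

  N-mono : ∀ {p q} → p ⊆ q → N G p ⊆ N G q
  N-mono p⊆q x∈Np = let y , y∈p , xy = ∈N⁻ x∈Np in ∈N⁺ (p⊆q y∈p) xy

  N-∪ : ∀ {p q} → N G (p ∪ q) ⊆ N G p ∪ N G q
  N-∪ {p} {q} x∈N = let y , y∈p∪q , xy = ∈N⁻ x∈N in
    x∈p∪q⁺ (Sum.map (λ y∈p → ∈N⁺ y∈p xy) (λ y∈q → ∈N⁺ y∈q xy) (x∈p∪q⁻ p q y∈p∪q))

  N-∩ : ∀ {p q} → N G (p ∩ q) ⊆ N G p ∩ N G q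
  N-∩ {p} {q} x∈N = x∈p∩q⁺ (N-mono (p∩q⊆p p q) x∈N , N-mono (p∩q⊆q p q) x∈N)

  Independent-⊆ : ∀ {p q} → p ⊆ q → Independent q → Independent p
  Independent-⊆ p⊆q indep x∈p y∈p = indep (p⊆q x∈p) (p⊆q y∈p)

  Independent⇒∉N : ∀ {S x} → Independent S → x ∈ S → x ∉ N G S
  Independent⇒∉N indep x∈S x∈NS = let y , y∈S , xy = ∈N⁻ x∈NS in indep x∈S y∈S xy

  isIndep⇒Independent : ∀ {S} → T (isIndep G S) → Independent S
  isIndep⇒Independent {S} t {x} {y} x∈S y∈S xy =
    T-not⁻ t (anyV⁺ _ {x} (anyV⁺ _ {y} (from (T-∧ {lookup S x})
      (∈⇒T-lookup x∈S , from (T-∧ {lookup S y}) (∈⇒T-lookup y∈S , xy)))))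

  Independent⇒isIndep : ∀ {S} → Independent S → T (isIndep G S)
  Independent⇒isIndep {S} indep = T-not⁺ λ t →
    let x , t₁ = anyV⁻ _ t
        y , t₂ = anyV⁻ _ t₁
        x∈S , t₃ = to (T-∧ {lookup S x}) t₂
        y∈S , xy = to (T-∧ {lookup S y}) t₃
    in indep (T-lookup⇒∈ x∈S) (T-lookup⇒∈ y∈S) xy

  record IsMaximumIndependent (W S : Subset n) : Set where
    field
      independent : Independent S
      within      : S ⊆ W
      size≡α      : ∣ S ∣ ≡ α G W

  open IsMaximumIndependent

  ∈indepSetsIn⁺ : ∀ {W S} → Independent S → S ⊆ W → S ∈ˡ indepSetsIn G W
  ∈indepSetsIn⁺ {W} {S} indep S⊆W = ∈-filter⁺ (λ S → T? (isIndep G S ∧ (S ⊆ᵇ W)))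
    (∈-allSubsets S) (from (T-∧ {isIndep G S}) (Independent⇒isIndep indep , ⊆⇒⊆ᵇ S⊆W))

  ∈indepSetsIn⁻ : ∀ {W S} → S ∈ˡ indepSetsIn G W → Independent S × S ⊆ W
  ∈indepSetsIn⁻ {W} {S} S∈ =
    let _ , t = ∈-filter⁻ (λ S → T? (isIndep G S ∧ (S ⊆ᵇ W))) {xs = allSubsets n} S∈
        indep , S⊆W = to (T-∧ {isIndep G S}) t
    in isIndep⇒Independent indep , ⊆ᵇ⇒⊆ S⊆W

  α-maximal : ∀ {W S} → Independent S → S ⊆ W → ∣ S ∣ ≤ α G W
  α-maximal indep S⊆W = ≤-foldr-⊔ (∈-map⁺ ∣_∣ (∈indepSetsIn⁺ indep S⊆W))

  ∈Ω⁺ : ∀ {W S} → IsMaximumIndependent W S → S ∈ˡ Ω G W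
  ∈Ω⁺ {W} {S} max = ∈-filter⁺ (λ S → T? (∣ S ∣ ≡ᵇ α G W))
    (∈indepSetsIn⁺ (independent max) (within max)) (≡⇒≡ᵇ _ _ (size≡α max))

  ∈Ω⁻ : ∀ {W S} → S ∈ˡ Ω G W → IsMaximumIndependent W S
  ∈Ω⁻ {W} {S} S∈Ω =
    let S∈ , t = ∈-filter⁻ (λ S → T? (∣ S ∣ ≡ᵇ α G W)) {xs = indepSetsIn G W} S∈Ω
        indep , S⊆W = ∈indepSetsIn⁻ S∈
    in record { independent = indep ; within = S⊆W ; size≡α = ≡ᵇ⇒≡ _ _ t }

  maximumIndependent : ∀ W → ∃ (IsMaximumIndependent W)
  maximumIndependent W with foldr-selective ⊔-sel 0 (map ∣_∣ (indepSetsIn G W))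
  ... | inj₁ α≡0 = ∅ , record
    { independent = λ x∈∅ _ _ → ∉⊥ x∈∅
    ; within      = λ x∈∅ → ⊥-elim (∉⊥ x∈∅)
    ; size≡α      = trans (∣⊥∣≡0 n) (≡.sym α≡0)
    }
  ... | inj₂ α∈ =
    let S , S∈ , α≡∣S∣ = ∈-map⁻ ∣_∣ α∈
        indep , S⊆W = ∈indepSetsIn⁻ S∈
    in S , record { independent = indep ; within = S⊆W ; size≡α = ≡.sym α≡∣S∣ }

  ∈core⁺ : ∀ {W x} → (∀ {S} → IsMaximumIndependent W S → x ∈ S) → x ∈ core G W
  ∈core⁺ {W} h = ∈⋂⁺ (Ω G W) (All.tabulate (h ∘ ∈Ω⁻))

  ∈core⁻ : ∀ {W x S} → x ∈ core G W → IsMaximumIndependent W S → x ∈ S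
  ∈core⁻ {W} x∈core max = All.lookup (∈⋂⁻ (Ω G W) x∈core) (∈Ω⁺ max)

  ∈corona⁺ : ∀ {W x S} → IsMaximumIndependent W S → x ∈ S → x ∈ corona G W
  ∈corona⁺ {W} max x∈S = ∈⋃⁺ (Ω G W) (lose (∈Ω⁺ max) x∈S)

  ∈corona⁻ : ∀ {W x} → x ∈ corona G W → ∃ λ S → IsMaximumIndependent W S × x ∈ S
  ∈corona⁻ {W} x∈corona =
    let S , S∈Ω , x∈S = find (∈⋃⁻ (Ω G W) x∈corona) in S , ∈Ω⁻ S∈Ω , x∈S

  core⊆ : ∀ W → core G W ⊆ W
  core⊆ W x∈core = let S , max = maximumIndependent W in within max (∈core⁻ x∈core max)

module CriticalIndependentSet (G : Graph n) (J : Subset n) (critical : IsCriticalIndep G J) where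

  open IsMaximumIndependent

  R : Subset n
  R = Lcset G J

  J-independent : Independent G J
  J-independent = isIndep⇒Independent G (from T-≡ (proj₁ critical))

  ∈J⇒∉NJ : ∀ {x} → x ∈ J → x ∉ N G J
  ∈J⇒∉NJ = Independent⇒∉N G J-independent

  ∈R⇒∉J : ∀ {x} → x ∈ R → x ∉ J
  ∈R⇒∉J x∈R = x∈∁p⇒x∉p x∈R ∘ x∈p∪q⁺ ∘ inj₁

  ∈R⇒∉NJ : ∀ {x} → x ∈ R → x ∉ N G J
  ∈R⇒∉NJ x∈R = x∈∁p⇒x∉p x∈R ∘ x∈p∪q⁺ ∘ inj₂

  hall : ∀ {T} → T ⊆ N G J → ∣ T ∣ ≤ ∣ J ∩ N G T ∣
  hall {T} T⊆NJ = +-cancelˡ-≤ (∣ J′ ∣ + ∣ N G J′ ∣) (∣ T ∣) (∣ J ∩ N G T ∣) (begin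
    ∣ J′ ∣ + ∣ N G J′ ∣ + ∣ T ∣          ≡⟨ +-assoc (∣ J′ ∣) (∣ N G J′ ∣) (∣ T ∣) ⟩
    ∣ J′ ∣ + (∣ N G J′ ∣ + ∣ T ∣)        ≤⟨ +-monoʳ-≤ ∣ J′ ∣ ∣NJ′∣+∣T∣≤∣NJ∣ ⟩
    ∣ J′ ∣ + ∣ N G J ∣                   ≤⟨ J′-vs-J ⟩
    ∣ J ∣ + ∣ N G J′ ∣                   ≡⟨ cong (_+ ∣ N G J′ ∣) (∣p∩q∣+∣p∩∁q∣≡∣p∣ J (N G T)) ⟨
    ∣ J ∩ N G T ∣ + ∣ J′ ∣ + ∣ N G J′ ∣  ≡⟨ +-assoc (∣ J ∩ N G T ∣) (∣ J′ ∣) (∣ N G J′ ∣) ⟩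
    ∣ J ∩ N G T ∣ + (∣ J′ ∣ + ∣ N G J′ ∣) ≡⟨ +-comm (∣ J ∩ N G T ∣) (∣ J′ ∣ + ∣ N G J′ ∣) ⟩
    ∣ J′ ∣ + ∣ N G J′ ∣ + ∣ J ∩ N G T ∣  ∎)
    where
    open ≤-Reasoning
    J′ : Subset n
    J′ = J ∩ ∁ (N G T)
    J′-vs-J : ∣ J′ ∣ + ∣ N G J ∣ ≤ ∣ J ∣ + ∣ N G J′ ∣
    J′-vs-J = m-n≤p-q⇒m+q≤p+n (∣ J′ ∣) (∣ N G J′ ∣) (∣ J ∣) (∣ N G J ∣) (proj₂ critical J′)
    disjoint : Empty (N G J′ ∩ T)
    disjoint (y , y∈NJ′∩T) =
      let y∈NJ′ , y∈T = x∈p∩q⁻ (N G J′) T y∈NJ′∩T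
          x , x∈J′ , yx = ∈N⁻ G y∈NJ′
      in x∈∁p⇒x∉p (proj₂ (x∈p∩q⁻ J _ x∈J′)) (∈N⁺ G y∈T (adj-sym G yx))
    ∣NJ′∣+∣T∣≤∣NJ∣ : ∣ N G J′ ∣ + ∣ T ∣ ≤ ∣ N G J ∣
    ∣NJ′∣+∣T∣≤∣NJ∣ = begin
      ∣ N G J′ ∣ + ∣ T ∣ ≡⟨ Empty[p∩q]⇒∣p∪q∣≡∣p∣+∣q∣ (N G J′) T disjoint ⟨
      ∣ N G J′ ∪ T ∣     ≤⟨ p⊆q⇒∣p∣≤∣q∣ ([ N-mono G (p∩q⊆p J _) , T⊆NJ ]′ ∘ x∈p∪q⁻ (N G J′) T) ⟩
      ∣ N G J ∣          ∎

  partition : ∀ P → ∣ P ∣ ≡ ∣ P ∩ J ∣ + ∣ P ∩ N G J ∣ + ∣ P ∩ R ∣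
  partition P = begin
    ∣ P ∣
      ≡⟨ ∣p∩q∣+∣p∩∁q∣≡∣p∣ P (J ∪ N G J) ⟨
    ∣ P ∩ (J ∪ N G J) ∣ + ∣ P ∩ R ∣
      ≡⟨ cong (λ A → ∣ A ∣ + ∣ P ∩ R ∣) (∩-distribˡ-∪ P J (N G J)) ⟩
    ∣ P ∩ J ∪ P ∩ N G J ∣ + ∣ P ∩ R ∣
      ≡⟨ cong (_+ ∣ P ∩ R ∣) (Empty[p∩q]⇒∣p∪q∣≡∣p∣+∣q∣ (P ∩ J) (P ∩ N G J) disjoint) ⟩
    ∣ P ∩ J ∣ + ∣ P ∩ N G J ∣ + ∣ P ∩ R ∣
      ∎
    where
    open ≡-Reasoning
    disjoint : Empty ((P ∩ J) ∩ (P ∩ N G J))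
    disjoint (x , x∈) =
      let x∈P∩J , x∈P∩NJ = x∈p∩q⁻ (P ∩ J) _ x∈
      in ∈J⇒∉NJ (proj₂ (x∈p∩q⁻ P J x∈P∩J)) (proj₂ (x∈p∩q⁻ P (N G J) x∈P∩NJ))

  J∩N[S∩NJ]⊆J∩∁S : ∀ {S} → Independent G S → J ∩ N G (S ∩ N G J) ⊆ J ∩ ∁ S
  J∩N[S∩NJ]⊆J∩∁S {S} indep x∈ =
    let x∈J , x∈N = x∈p∩q⁻ J _ x∈
    in x∈p∩q⁺ (x∈J , x∉p⇒x∈∁p λ x∈S → Independent⇒∉N G indep x∈S (N-mono G (p∩q⊆p S _) x∈N))

  ∣S∩J∣+∣J∩∁S∣≡∣J∣ : ∀ S → ∣ S ∩ J ∣ + ∣ J ∩ ∁ S ∣ ≡ ∣ J ∣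
  ∣S∩J∣+∣J∩∁S∣≡∣J∣ S = trans (cong (λ A → ∣ A ∣ + ∣ J ∩ ∁ S ∣) (∩-comm S J)) (∣p∩q∣+∣p∩∁q∣≡∣p∣ J S)

  ∣S∩J∣+∣S∩NJ∣≤∣J∣ : ∀ {S} → Independent G S → ∣ S ∩ J ∣ + ∣ S ∩ N G J ∣ ≤ ∣ J ∣
  ∣S∩J∣+∣S∩NJ∣≤∣J∣ {S} indep = begin
    ∣ S ∩ J ∣ + ∣ S ∩ N G J ∣
      ≤⟨ +-monoʳ-≤ ∣ S ∩ J ∣ (hall (p∩q⊆q S (N G J))) ⟩
    ∣ S ∩ J ∣ + ∣ J ∩ N G (S ∩ N G J) ∣
      ≤⟨ +-monoʳ-≤ ∣ S ∩ J ∣ (p⊆q⇒∣p∣≤∣q∣ (J∩N[S∩NJ]⊆J∩∁S indep)) ⟩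
    ∣ S ∩ J ∣ + ∣ J ∩ ∁ S ∣
      ≡⟨ ∣S∩J∣+∣J∩∁S∣≡∣J∣ S ⟩
    ∣ J ∣
      ∎
    where open ≤-Reasoning

  ∣S∩R∣≤α[R] : ∀ {S} → Independent G S → ∣ S ∩ R ∣ ≤ α G R
  ∣S∩R∣≤α[R] {S} indep = α-maximal G (Independent-⊆ G (p∩q⊆p S R) indep) (p∩q⊆q S R)

  J∪S-independent : ∀ {S} → Independent G S → S ⊆ R → Independent G (J ∪ S)
  J∪S-independent {S} indep S⊆R {x} {y} x∈J∪S y∈J∪S xy
    with x∈p∪q⁻ J S x∈J∪S | x∈p∪q⁻ J S y∈J∪S
  ... | inj₁ x∈J | inj₁ y∈J = J-independent x∈J y∈J xy
  ... | inj₁ x∈J | inj₂ y∈S = ∈R⇒∉NJ (S⊆R y∈S) (∈N⁺ G x∈J (adj-sym G xy))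
  ... | inj₂ x∈S | inj₁ y∈J = ∈R⇒∉NJ (S⊆R x∈S) (∈N⁺ G y∈J xy)
  ... | inj₂ x∈S | inj₂ y∈S = indep x∈S y∈S xy

  ∣J∪S∣≡∣J∣+∣S∣ : ∀ {S} → S ⊆ R → ∣ J ∪ S ∣ ≡ ∣ J ∣ + ∣ S ∣
  ∣J∪S∣≡∣J∣+∣S∣ {S} S⊆R = Empty[p∩q]⇒∣p∪q∣≡∣p∣+∣q∣ J S λ (x , x∈J∩S) →
    let x∈J , x∈S = x∈p∩q⁻ J S x∈J∩S in ∈R⇒∉J (S⊆R x∈S) x∈J

  α≡∣J∣+α[R] : α G ⊤ ≡ ∣ J ∣ + α G R
  α≡∣J∣+α[R] = ≤-antisym α≤∣J∣+α[R] ∣J∣+α[R]≤α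
    where
    open ≤-Reasoning
    α≤∣J∣+α[R] : α G ⊤ ≤ ∣ J ∣ + α G R
    α≤∣J∣+α[R] = let S , max = maximumIndependent G ⊤ in begin
      α G ⊤                                 ≡⟨ size≡α max ⟨
      ∣ S ∣                                 ≡⟨ partition S ⟩
      ∣ S ∩ J ∣ + ∣ S ∩ N G J ∣ + ∣ S ∩ R ∣ ≤⟨ +-mono-≤ (∣S∩J∣+∣S∩NJ∣≤∣J∣ (independent max))
                                                         (∣S∩R∣≤α[R] (independent max)) ⟩
      ∣ J ∣ + α G R                         ∎
    ∣J∣+α[R]≤α : ∣ J ∣ + α G R ≤ α G ⊤
    ∣J∣+α[R]≤α = let S , max = maximumIndependent G R in begin
      ∣ J ∣ + α G R ≡⟨ cong (∣ J ∣ +_) (size≡α max) ⟨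
      ∣ J ∣ + ∣ S ∣ ≡⟨ ∣J∪S∣≡∣J∣+∣S∣ (within max) ⟨
      ∣ J ∪ S ∣     ≤⟨ α-maximal G (J∪S-independent (independent max) (within max)) ⊆⊤ ⟩
      α G ⊤         ∎

  extend : ∀ {S} → IsMaximumIndependent G R S → IsMaximumIndependent G ⊤ (J ∪ S)
  extend {S} max = record
    { independent = J∪S-independent (independent max) (within max)
    ; within      = ⊆⊤
    ; size≡α      = trans (∣J∪S∣≡∣J∣+∣S∣ (within max))
                      (trans (cong (∣ J ∣ +_) (size≡α max)) (≡.sym α≡∣J∣+α[R]))
    }

  maximum-split : ∀ {S} → IsMaximumIndependent G ⊤ S →
                  ∣ S ∩ J ∣ + ∣ S ∩ N G J ∣ ≡ ∣ J ∣ × ∣ S ∩ R ∣ ≡ α G R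
  maximum-split {S} max = +-mono-≤-tight
    (∣S∩J∣+∣S∩NJ∣≤∣J∣ (independent max))
    (∣S∩R∣≤α[R] (independent max))
    (trans (≡.sym (partition S)) (trans (size≡α max) α≡∣J∣+α[R]))

  restrict : ∀ {S} → IsMaximumIndependent G ⊤ S → IsMaximumIndependent G R (S ∩ R)
  restrict {S} max = record
    { independent = Independent-⊆ G (p∩q⊆p S R) (independent max)
    ; within      = p∩q⊆q S R
    ; size≡α      = proj₂ (maximum-split max)
    }

  ∣J∩∁S∣≡∣S∩NJ∣ : ∀ {S} → IsMaximumIndependent G ⊤ S → ∣ J ∩ ∁ S ∣ ≡ ∣ S ∩ N G J ∣
  ∣J∩∁S∣≡∣S∩NJ∣ {S} max = +-cancelˡ-≡ ∣ S ∩ J ∣ _ _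
    (trans (∣S∩J∣+∣J∩∁S∣≡∣J∣ S) (≡.sym (proj₁ (maximum-split max))))

  J∩∁S⊆N[S∩NJ] : ∀ {S} → IsMaximumIndependent G ⊤ S → J ∩ ∁ S ⊆ N G (S ∩ N G J)
  J∩∁S⊆N[S∩NJ] {S} max = proj₂ ∘ x∈p∩q⁻ J _ ∘ p⊆q∧∣q∣≤∣p∣⇒q⊆p
    (J∩N[S∩NJ]⊆J∩∁S (independent max))
    (≤-trans (≤-reflexive (∣J∩∁S∣≡∣S∩NJ∣ max)) (hall (p∩q⊆q S (N G J))))

  Tight : Subset n → Set
  Tight T = ∣ J ∩ N G T ∣ ≤ ∣ T ∣

  tight-maximum : ∀ {S} → IsMaximumIndependent G ⊤ S → Tight (S ∩ N G J)
  tight-maximum {S} max = ≤-trans (p⊆q⇒∣p∣≤∣q∣ (J∩N[S∩NJ]⊆J∩∁S (independent max)))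
                                  (≤-reflexive (∣J∩∁S∣≡∣S∩NJ∣ max))

  tight-∅ : Tight ∅
  tight-∅ = p⊆q⇒∣p∣≤∣q∣ J∩N∅⊆∅
    where
    J∩N∅⊆∅ : J ∩ N G ∅ ⊆ ∅
    J∩N∅⊆∅ x∈J∩N∅ = let _ , y∈∅ , _ = ∈N⁻ G (proj₂ (x∈p∩q⁻ J _ x∈J∩N∅)) in ⊥-elim (∉⊥ y∈∅)

  -- Submodularity of T ↦ ∣J ∩ N(T)∣, with Hall's condition bounding the term of A ∩ B.
  tight-∪ : ∀ {A B} → A ⊆ N G J → B ⊆ N G J → Tight A → Tight B → Tight (A ∪ B)
  tight-∪ {A} {B} A⊆NJ B⊆NJ tight-A tight-B = +-cancelʳ-≤ (∣ J ∩ N G (A ∩ B) ∣) _ _ (begin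
    ∣ J ∩ N G (A ∪ B) ∣ + ∣ J ∩ N G (A ∩ B) ∣   ≤⟨ +-mono-≤ (p⊆q⇒∣p∣≤∣q∣ ⊆∪) (p⊆q⇒∣p∣≤∣q∣ ⊆∩) ⟩
    ∣ JA ∪ JB ∣ + ∣ JA ∩ JB ∣                   ≡⟨ ∣p∪q∣+∣p∩q∣≡∣p∣+∣q∣ JA JB ⟩
    ∣ JA ∣ + ∣ JB ∣                             ≤⟨ +-mono-≤ tight-A tight-B ⟩
    ∣ A ∣ + ∣ B ∣                               ≡⟨ ∣p∪q∣+∣p∩q∣≡∣p∣+∣q∣ A B ⟨
    ∣ A ∪ B ∣ + ∣ A ∩ B ∣                       ≤⟨ +-monoʳ-≤ ∣ A ∪ B ∣ (hall (A⊆NJ ∘ p∩q⊆p A B)) ⟩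
    ∣ A ∪ B ∣ + ∣ J ∩ N G (A ∩ B) ∣             ∎)
    where
    open ≤-Reasoning
    JA JB : Subset n
    JA = J ∩ N G A
    JB = J ∩ N G B
    ⊆∪ : J ∩ N G (A ∪ B) ⊆ JA ∪ JB
    ⊆∪ x∈ = let x∈J , x∈N = x∈p∩q⁻ J _ x∈ in x∈p∪q⁺ {p = JA} {q = JB}
      ([ (λ x∈NA → inj₁ (x∈p∩q⁺ (x∈J , x∈NA))) , (λ x∈NB → inj₂ (x∈p∩q⁺ (x∈J , x∈NB))) ]′
         (x∈p∪q⁻ (N G A) (N G B) (N-∪ G {A} {B} x∈N)))
    ⊆∩ : J ∩ N G (A ∩ B) ⊆ JA ∩ JB
    ⊆∩ x∈ = let x∈J , x∈N = x∈p∩q⁻ J _ x∈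
                x∈NA , x∈NB = x∈p∩q⁻ (N G A) (N G B) (N-∩ G {A} {B} x∈N)
            in x∈p∩q⁺ {p = JA} {q = JB} (x∈p∩q⁺ (x∈J , x∈NA) , x∈p∩q⁺ (x∈J , x∈NB))

  tight-⋃ : ∀ Ss → All (λ S → Tight (S ∩ N G J)) Ss → Tight (⋃ Ss ∩ N G J)
  tight-⋃ []       []       = subst Tight (≡.sym (∩-zeroˡ (N G J))) tight-∅
  tight-⋃ (S ∷ Ss) (t ∷ ts) = subst Tight (≡.sym (∩-distribʳ-∪ (N G J) S (⋃ Ss)))
    (tight-∪ (p∩q⊆q S _) (p∩q⊆q (⋃ Ss) _) t (tight-⋃ Ss ts))

  C : Subset n
  C = corona G ⊤ ∩ N G J

  ∣C∣≡∣J∩NC∣ : ∣ C ∣ ≡ ∣ J ∩ N G C ∣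
  ∣C∣≡∣J∩NC∣ = ≤-antisym (hall (p∩q⊆q (corona G ⊤) (N G J)))
                         (tight-⋃ (Ω G ⊤) (All.tabulate (tight-maximum ∘ ∈Ω⁻ G)))

  core∩R≡core[R] : core G ⊤ ∩ R ≡ core G R
  core∩R≡core[R] = ⊆-antisym forward backward
    where
    forward : core G ⊤ ∩ R ⊆ core G R
    forward x∈ = let x∈core , x∈R = x∈p∩q⁻ (core G ⊤) R x∈ in ∈core⁺ G λ {S} max →
      [ ⊥-elim ∘ ∈R⇒∉J x∈R , id ]′ (x∈p∪q⁻ J S (∈core⁻ G x∈core (extend max)))
    backward : core G R ⊆ core G ⊤ ∩ R
    backward x∈ = x∈p∩q⁺
      (∈core⁺ G (λ {S} max → proj₁ (x∈p∩q⁻ S R (∈core⁻ G x∈ (restrict max)))) , core⊆ G R x∈)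

  corona∩R≡corona[R] : corona G ⊤ ∩ R ≡ corona G R
  corona∩R≡corona[R] = ⊆-antisym forward backward
    where
    forward : corona G ⊤ ∩ R ⊆ corona G R
    forward x∈ =
      let x∈corona , x∈R = x∈p∩q⁻ (corona G ⊤) R x∈
          S , max , x∈S = ∈corona⁻ G x∈corona
      in ∈corona⁺ G (restrict max) (x∈p∩q⁺ (x∈S , x∈R))
    backward : corona G R ⊆ corona G ⊤ ∩ R
    backward x∈ =
      let S , max , x∈S = ∈corona⁻ G x∈
      in x∈p∩q⁺ (∈corona⁺ G (extend max) (x∈p∪q⁺ (inj₂ x∈S)) , within max x∈S)

  core∩NJ-empty : Empty (core G ⊤ ∩ N G J)
  core∩NJ-empty (x , x∈) =
    let x∈core , x∈NJ = x∈p∩q⁻ (core G ⊤) (N G J) x∈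
        S , max = maximumIndependent G R
    in [ (λ x∈J → ∈J⇒∉NJ x∈J x∈NJ) , (λ x∈S → ∈R⇒∉NJ (within max x∈S) x∈NJ) ]′
         (x∈p∪q⁻ J S (∈core⁻ G x∈core (extend max)))

  core∩J≡J∩∁NC : core G ⊤ ∩ J ≡ J ∩ ∁ (N G C)
  core∩J≡J∩∁NC = ⊆-antisym forward backward
    where
    forward : core G ⊤ ∩ J ⊆ J ∩ ∁ (N G C)
    forward x∈ = let x∈core , x∈J = x∈p∩q⁻ (core G ⊤) J x∈ in x∈p∩q⁺ (x∈J , x∉p⇒x∈∁p λ x∈NC →
      let y , y∈C , xy = ∈N⁻ G x∈NC
          S , max , y∈S = ∈corona⁻ G {⊤} (proj₁ (x∈p∩q⁻ (corona G ⊤) (N G J) y∈C))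
      in independent max (∈core⁻ G x∈core max) y∈S xy)
    S∩NJ⊆C : ∀ {S} → IsMaximumIndependent G ⊤ S → S ∩ N G J ⊆ C
    S∩NJ⊆C {S} max x∈ = let x∈S , x∈NJ = x∈p∩q⁻ S (N G J) x∈ in x∈p∩q⁺ (∈corona⁺ G max x∈S , x∈NJ)
    backward : J ∩ ∁ (N G C) ⊆ core G ⊤ ∩ J
    backward x∈ = let x∈J , x∈∁NC = x∈p∩q⁻ J (∁ (N G C)) x∈ in x∈p∩q⁺ (∈core⁺ G (λ {S} max →
      decidable-stable (_ ∈? S) λ x∉S → x∈∁p⇒x∉p x∈∁NC
        (N-mono G (S∩NJ⊆C max) (J∩∁S⊆N[S∩NJ] max (x∈p∩q⁺ (x∈J , x∉p⇒x∈∁p x∉S))))) , x∈J)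

  corona∩J≡J : corona G ⊤ ∩ J ≡ J
  corona∩J≡J = ⊆-antisym (p∩q⊆q (corona G ⊤) J) λ x∈J →
    let S , max = maximumIndependent G R
    in x∈p∩q⁺ (∈corona⁺ G (extend max) (x∈p∪q⁺ (inj₁ x∈J)) , x∈J)

  ∣core∣≡∣J∩∁NC∣+∣core[R]∣ : ∣ core G ⊤ ∣ ≡ ∣ J ∩ ∁ (N G C) ∣ + ∣ core G R ∣
  ∣core∣≡∣J∩∁NC∣+∣core[R]∣ = begin
    ∣ core G ⊤ ∣
      ≡⟨ partition (core G ⊤) ⟩
    ∣ core G ⊤ ∩ J ∣ + ∣ core G ⊤ ∩ N G J ∣ + ∣ core G ⊤ ∩ R ∣
      ≡⟨ cong (λ m → ∣ core G ⊤ ∩ J ∣ + m + ∣ core G ⊤ ∩ R ∣) ∣core∩NJ∣≡0 ⟩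
    ∣ core G ⊤ ∩ J ∣ + 0 + ∣ core G ⊤ ∩ R ∣
      ≡⟨ cong (_+ ∣ core G ⊤ ∩ R ∣) (+-identityʳ ∣ core G ⊤ ∩ J ∣) ⟩
    ∣ core G ⊤ ∩ J ∣ + ∣ core G ⊤ ∩ R ∣
      ≡⟨ cong₂ (λ A B → ∣ A ∣ + ∣ B ∣) core∩J≡J∩∁NC core∩R≡core[R] ⟩
    ∣ J ∩ ∁ (N G C) ∣ + ∣ core G R ∣
      ∎
    where
    open ≡-Reasoning
    ∣core∩NJ∣≡0 : ∣ core G ⊤ ∩ N G J ∣ ≡ 0
    ∣core∩NJ∣≡0 = trans (cong ∣_∣ (Empty-unique core∩NJ-empty)) (∣⊥∣≡0 n)

  ∣corona∣≡∣J∣+∣J∩NC∣+∣corona[R]∣ : ∣ corona G ⊤ ∣ ≡ ∣ J ∣ + ∣ J ∩ N G C ∣ + ∣ corona G R ∣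
  ∣corona∣≡∣J∣+∣J∩NC∣+∣corona[R]∣ = trans (partition (corona G ⊤))
    (cong₂ _+_ (cong₂ _+_ (cong ∣_∣ corona∩J≡J) ∣C∣≡∣J∩NC∣) (cong ∣_∣ corona∩R≡corona[R]))

  ∣core∣+∣corona∣≡∣J∣+∣J∣+∣core[R]∣+∣corona[R]∣ :
    ∣ core G ⊤ ∣ + ∣ corona G ⊤ ∣ ≡ ∣ J ∣ + ∣ J ∣ + (∣ core G R ∣ + ∣ corona G R ∣)
  ∣core∣+∣corona∣≡∣J∣+∣J∣+∣core[R]∣+∣corona[R]∣ = begin
    ∣ core G ⊤ ∣ + ∣ corona G ⊤ ∣
      ≡⟨ cong₂ _+_ ∣core∣≡∣J∩∁NC∣+∣core[R]∣ ∣corona∣≡∣J∣+∣J∩NC∣+∣corona[R]∣ ⟩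
    ∣ J ∩ ∁ (N G C) ∣ + ∣ core G R ∣ + (∣ J ∣ + ∣ J ∩ N G C ∣ + ∣ corona G R ∣)
      ≡⟨ regroup (∣ J ∩ N G C ∣) (∣ J ∩ ∁ (N G C) ∣) (∣ J ∣) (∣ core G R ∣) (∣ corona G R ∣) ⟩
    ∣ J ∩ N G C ∣ + ∣ J ∩ ∁ (N G C) ∣ + ∣ J ∣ + (∣ core G R ∣ + ∣ corona G R ∣)
      ≡⟨ cong (λ m → m + ∣ J ∣ + (∣ core G R ∣ + ∣ corona G R ∣)) (∣p∩q∣+∣p∩∁q∣≡∣p∣ J (N G C)) ⟩
    ∣ J ∣ + ∣ J ∣ + (∣ core G R ∣ + ∣ corona G R ∣)
      ∎
    where
    open ≡-Reasoning
    regroup : ∀ a b j c d → b + c + (j + a + d) ≡ a + b + j + (c + d)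
    regroup = solve-∀

mainTheorem4 : ∀ {n} (G : Graph n) (J : Subset n) → IsMaxCriticalIndep G J → (k : ℕ)
    → ∣ core G (Lcset G J) ∣ + ∣ corona G (Lcset G J) ∣ ≡ 2 * α G (Lcset G J) + k
    → ∣ core G ⊤ ∣ + ∣ corona G ⊤ ∣ ≡ 2 * α G ⊤ + k
mainTheorem4 G J (critical , _) k hyp = begin
  ∣ core G ⊤ ∣ + ∣ corona G ⊤ ∣
    ≡⟨ ∣core∣+∣corona∣≡∣J∣+∣J∣+∣core[R]∣+∣corona[R]∣ ⟩
  ∣ J ∣ + ∣ J ∣ + (∣ core G R ∣ + ∣ corona G R ∣)
    ≡⟨ cong (∣ J ∣ + ∣ J ∣ +_) hyp ⟩
  ∣ J ∣ + ∣ J ∣ + (2 * α G R + k)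
    ≡⟨ regroup (∣ J ∣) (α G R) k ⟩
  2 * (∣ J ∣ + α G R) + k
    ≡⟨ cong (λ a → 2 * a + k) α≡∣J∣+α[R] ⟨
  2 * α G ⊤ + k
    ∎
  where
  open CriticalIndependentSet G J critical
  open ≡-Reasoning
  regroup : ∀ j a k → j + j + (2 * a + k) ≡ 2 * (j + a) + k
  regroup = solve-∀
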